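{- Let $G$ be a finite, connected, undirected multigraph without loops, and fix distinct vertices $x,y$ of $G$. Let $G_1$ be the multigraph obtained from $G$ by either adding one edge between $x$ and $y$ or removing one edge between $x$ and $y$, and assume $G_1$ is connected. Then $[\delta_{xy}]$ generates $\mathrm{Jac}(G)$ if and only if $\gcd(|\mathrm{Jac}(G)|,|\mathrm{Jac}(G_1)|)=1$.
   Context: For a finite connected loopless multigraph $H$ with vertex set $V(H)$: a divisor is an element of $\mathbb{Z}^{V(H)}$; its degree is the sum of its values; $\mathrm{Div}^0(H)$ is the group of degree-zero divisors. The Laplacian is $L=\Delta-A$, where $\Delta$ is the diagonal matrix of vertex valencies and $A_{vw}$ is the number of edges between $v$ and $w$. Principal divisors are those of the form $L\sigma$ with $\sigma\in\mathbb{Z}^{V(H)}$, and $\mathrm{Jac}(H)=\mathrm{Div}^0(H)/\{L\sigma\}$, a finite abelian group whose order equals the number of spanning trees of $H$. For vertices $x\neq y$, $\delta_{xy}$ is the divisor with value $-1$ at $x$, $1$ at $y$ and $0$ elsewhere, and $[\delta_{xy}]$ is its class in the Jacobian. -}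

module Defs where

open import Data.Nat as ℕ using (ℕ; zero; suc)
open import Data.Integer as ℤ using (ℤ; +_; _-_; _*_; -_)
open import Data.Fin using (Fin; zero; suc)
open import Data.Fin.Properties using (_≟_)
open import Data.Product using (Σ; ∃; ∃-syntax; _×_; _,_)
open import Data.Sum using (_⊎_)
open import Relation.Nullary using (¬_; yes; no)
open import Relation.Binary.PropositionalEquality using (_≡_)

∑ : {n : ℕ} → (Fin n → ℤ) → ℤ
∑ {zero}  f = + 0
∑ {suc n} f = f zero ℤ.+ ∑ (λ i → f (suc i))

-- A finite loopless undirected multigraph on vertex set Fin n,
-- given by its (symmetric, zero-diagonal) adjacency matrix:
-- adj v w = number of edges between v and w.
record Multigraph (n : ℕ) : Set where
  field
    adj      : Fin n → Fin n → ℕ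
    adj-sym  : ∀ v w → adj v w ≡ adj w v
    loopless : ∀ v → adj v v ≡ 0
open Multigraph public

data Walk {n : ℕ} (H : Multigraph n) : Fin n → Fin n → Set where
  here : ∀ {v} → Walk H v v
  step : ∀ {u v w} → ℕ._<_ 0 (adj H u v) → Walk H v w → Walk H u w

Connected : {n : ℕ} → Multigraph n → Set
Connected H = ∀ u v → Walk H u v

Divisor : ℕ → Set
Divisor n = Fin n → ℤ

deg : {n : ℕ} → Divisor n → ℤ
deg D = ∑ D

valency : {n : ℕ} → Multigraph n → Fin n → ℤ
valency H v = ∑ (λ w → + adj H v w)

Laplacian : {n : ℕ} → Multigraph n → (Fin n → ℤ) → Divisor n
Laplacian H σ v = valency H v * σ v - ∑ (λ w → + adj H v w * σ w)

_∼[_]_ : {n : ℕ} → Divisor n → Multigraph n → Divisor n → Set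
_∼[_]_ {n} D H D' = ∃[ σ ] (∀ v → D v - D' v ≡ Laplacian H σ v)

Div0 : ℕ → Set
Div0 n = Σ (Divisor n) (λ D → deg D ≡ + 0)

-- Jac(H) = Div^0(H) / principal divisors has exactly N elements:
-- a bijection between Fin N and Div^0(H) modulo linear equivalence.
JacHasOrder : {n : ℕ} → Multigraph n → ℕ → Set
JacHasOrder {n} H N =
  Σ (Fin N → Div0 n) λ f →
    (∀ (D : Div0 n) → ∃[ i ] (Data.Product.proj₁ (f i) ∼[ H ] Data.Product.proj₁ D))
    × (∀ i j → Data.Product.proj₁ (f i) ∼[ H ] Data.Product.proj₁ (f j) → i ≡ j)

δ : {n : ℕ} → Fin n → Fin n → Divisor n
δ x y v with v ≟ x | v ≟ y
... | yes _ | _     = - (+ 1)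
... | no _  | yes _ = + 1
... | no _  | no _  = + 0

Generates : {n : ℕ} → Multigraph n → Fin n → Fin n → Set
Generates {n} H x y =
  ∀ (D : Divisor n) → deg D ≡ + 0 → ∃[ k ] (D ∼[ H ] (λ v → k * δ x y v))

edgeXY : {n : ℕ} → Fin n → Fin n → Fin n → Fin n → ℕ
edgeXY x y u v with u ≟ x | v ≟ y | u ≟ y | v ≟ x
... | yes _ | yes _ | _     | _     = 1
... | _     | _     | yes _ | yes _ = 1
... | _     | _     | _     | _     = 0

data OneEdgeChange {n : ℕ} (G : Multigraph n) (x y : Fin n) (G1 : Multigraph n) : Set where
  added   : (∀ u v → adj G1 u v ≡ adj G u v ℕ.+ edgeXY x y u v) → OneEdgeChange G x y G1
  removed : (∀ u v → adj G u v ≡ adj G1 u v ℕ.+ edgeXY x y u v) → OneEdgeChange G x y G1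

-- Write Λ_H for the principal divisors of H and δ for δ_xy.  Adding or removing an x–y edge changes the
-- Laplacian by L_G1 τ = L_G τ ± (τ y − τ x)·δ, so Λ_G + ℤδ = Λ_G1 + ℤδ.
-- (⇐) For D of degree 0, N·D ∈ Λ_G and N1·D ∈ Λ_G1 (translation by [D] permutes a group of order N,
-- resp. N1), so both lie in Λ_G + ℤδ, and by Bézout so does D.
-- (⇒) Let L_G σ = N·δ and s = σ y − σ x.  Then L_G1 σ = (N ± s)·δ, and δ also generates Jac(G1),
-- so N1 divides N ± s and g = gcd(N, N1) divides s.  Writing δ_xv ∼ k·δ and pairing with σ, the
-- self-adjointness of L_G gives σ v − σ x ≡ k s (mod N), hence σ v ≡ σ x (mod g).  So σ = σ x + g·τ
-- with L_G τ = (N/g)·δ, and as [δ] has order N, g = 1.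

module Submission where

open import Defs
open import Data.Nat using (ℕ)
open import Data.Nat.GCD using (gcd)
open import Data.Fin using (Fin)
open import Relation.Nullary using (¬_)
open import Relation.Binary.PropositionalEquality using (_≡_)
open import Function.Bundles using (_⇔_)

import Data.Integer.Properties as ℤ
open import Algebra.Properties.Semiring.Sum ℤ.+-*-semiring
  using (sum; sum-cong-≗; sum-replicate-zero; sum-remove; sum-permute; ∑-distrib-+; ∑-comm; *-distribˡ-sum; *-distribʳ-sum)
open import Data.Fin using (zero; suc; punchIn; punchOut; toℕ; fromℕ<)
open import Data.Fin.Permutation using (Permutation; permutation)
open import Data.Fin.Properties
  using (_≟_; suc-injective; punchInᵢ≢i; punchIn-injective; punchIn-punchOut; nonZeroIndex; injective⇒≤; toℕ-fromℕ<)
open import Data.Integer using (ℤ; +_; 0ℤ; -1ℤ; 1ℤ; _+_; _-_; _*_; -_; _%ℕ_; _/ℕ_)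
open import Data.Integer.DivMod using (a≡a%ℕn+[a/ℕn]*n; n%ℕd<d)
open import Data.Integer.Divisibility.Signed
  using (_∣_; divides; ∣ᵤ⇒∣; ∣⇒∣ᵤ; ∣-trans; ∣m∣n⇒∣m+n; ∣m+n∣m⇒∣n; ∣n⇒∣m*n; ∣m⇒∣-m)
open import Data.Integer.Tactic.RingSolver using (solve-∀)
open import Data.Nat as ℕ using (zero; suc)
import Data.Nat.Divisibility as ℕ
open import Data.Nat.GCD using (gcd-GCD; gcd[m,n]∣m; gcd[m,n]∣n; module Bézout)
import Data.Nat.Properties as ℕ
open import Data.Product using (∃-syntax; _×_; _,_; proj₁; proj₂)
open import Data.Sum using (_⊎_; inj₁; inj₂)
open import Function.Base using (_∘_)
open import Function.Bundles using (mk⇔)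
open import Relation.Binary.PropositionalEquality using (_≢_; refl; sym; trans; cong; cong₂; subst; module ≡-Reasoning)
open import Relation.Nullary using (Dec; yes; no; contradiction)

open ≡-Reasoning

∑≡sum : ∀ {n} (f : Fin n → ℤ) → ∑ f ≡ sum f
∑≡sum {zero}  f = refl
∑≡sum {suc n} f = cong (_+_ (f zero)) (∑≡sum (f ∘ suc))

sum-zero : ∀ {n} {f : Fin n → ℤ} → (∀ i → f i ≡ 0ℤ) → sum f ≡ 0ℤ
sum-zero {n} f≡0 = trans (sum-cong-≗ f≡0) (sum-replicate-zero n)

sum-const : ∀ n (c : ℤ) → sum {n} (λ _ → c) ≡ + n * c
sum-const zero    c = refl
sum-const (suc n) c = trans (cong (_+_ c) (sum-const n c)) (sym (ℤ.suc-* (+ n) c))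

sum-neg : ∀ {n} (f : Fin n → ℤ) → sum (λ i → - f i) ≡ - sum f
sum-neg {zero}  f = refl
sum-neg {suc n} f = trans (cong (_+_ (- f zero)) (sum-neg (f ∘ suc))) (sym (ℤ.neg-distrib-+ (f zero) _))

sum-sub : ∀ {n} (f g : Fin n → ℤ) → sum (λ i → f i - g i) ≡ sum f - sum g
sum-sub f g = trans (∑-distrib-+ f (λ i → - g i)) (cong (_+_ (sum f)) (sum-neg g))

sum-single : ∀ {n} (f : Fin n → ℤ) (j : Fin n) → (∀ i → i ≢ j → f i ≡ 0ℤ) → sum f ≡ f j
sum-single f zero    f≡0 =
  trans (cong (_+_ (f zero)) (sum-zero (λ i → f≡0 (suc i) λ ()))) (ℤ.+-identityʳ (f zero))
sum-single f (suc j) f≡0 = trans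
  (cong₂ _+_ (f≡0 zero λ ()) (sum-single (f ∘ suc) j (λ i i≢j → f≡0 (suc i) (i≢j ∘ suc-injective))))
  (ℤ.+-identityˡ (f (suc j)))

sum-pair : ∀ {n} (f : Fin n → ℤ) {x y : Fin n} → x ≢ y →
           (∀ w → w ≢ x → w ≢ y → f w ≡ 0ℤ) → sum f ≡ f x + f y
sum-pair {suc n} f {x} {y} x≢y f≡0 = begin
  sum f                               ≡⟨ sum-remove {i = x} f ⟩
  f x + sum (f ∘ punchIn x)           ≡⟨ cong (_+_ (f x)) (sum-single (f ∘ punchIn x) (punchOut x≢y) off-y) ⟩
  f x + f (punchIn x (punchOut x≢y))  ≡⟨ cong (λ w → f x + f w) (punchIn-punchOut x≢y) ⟩
  f x + f y                           ∎
  where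
  off-y : ∀ k → k ≢ punchOut x≢y → f (punchIn x k) ≡ 0ℤ
  off-y k k≢ = f≡0 (punchIn x k) (punchInᵢ≢i x k)
    (λ eq → k≢ (punchIn-injective x k _ (trans eq (sym (punchIn-punchOut x≢y)))))

deg-zero : ∀ n → deg {n} (λ _ → 0ℤ) ≡ 0ℤ
deg-zero n = trans (∑≡sum {n} (λ _ → 0ℤ)) (sum-zero {n} (λ _ → refl))

deg-+ : ∀ {n} (D E : Divisor n) → deg D ≡ 0ℤ → deg E ≡ 0ℤ → deg (λ v → D v + E v) ≡ 0ℤ
deg-+ D E degD degE = begin
  ∑ (λ v → D v + E v)   ≡⟨ ∑≡sum (λ v → D v + E v) ⟩
  sum (λ v → D v + E v) ≡⟨ ∑-distrib-+ D E ⟩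
  sum D + sum E         ≡⟨ cong₂ _+_ (trans (sym (∑≡sum D)) degD) (trans (sym (∑≡sum E)) degE) ⟩
  0ℤ                    ∎

deg-scale : ∀ {n} k (D : Divisor n) → deg D ≡ 0ℤ → deg (λ v → k * D v) ≡ 0ℤ
deg-scale k D degD = begin
  ∑ (λ v → k * D v)   ≡⟨ ∑≡sum (λ v → k * D v) ⟩
  sum (λ v → k * D v) ≡⟨ *-distribˡ-sum k D ⟨
  k * sum D           ≡⟨ cong (k *_) (trans (sym (∑≡sum D)) degD) ⟩
  k * 0ℤ              ≡⟨ ℤ.*-zeroʳ k ⟩
  0ℤ                  ∎

⟪_,_⟫ : ∀ {n} → (Fin n → ℤ) → (Fin n → ℤ) → ℤ
⟪ D , σ ⟫ = sum (λ v → D v * σ v)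

pairing-comm : ∀ {n} (D σ : Fin n → ℤ) → ⟪ D , σ ⟫ ≡ ⟪ σ , D ⟫
pairing-comm D σ = sum-cong-≗ (λ v → ℤ.*-comm (D v) (σ v))

pairing-scaleʳ : ∀ {n} (D σ : Fin n → ℤ) k → ⟪ D , (λ v → k * σ v) ⟫ ≡ k * ⟪ D , σ ⟫
pairing-scaleʳ D σ k = begin
  sum (λ v → D v * (k * σ v)) ≡⟨ sum-cong-≗ (λ v → swap (D v) k (σ v)) ⟩
  sum (λ v → k * (D v * σ v)) ≡⟨ *-distribˡ-sum k (λ v → D v * σ v) ⟨
  k * ⟪ D , σ ⟫               ∎
  where
  swap : ∀ d k s → d * (k * s) ≡ k * (d * s)
  swap = solve-∀

pairing-split : ∀ {n} (D B σ : Fin n → ℤ) k →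
                ⟪ D , σ ⟫ ≡ ⟪ (λ v → D v - k * B v) , σ ⟫ + k * ⟪ B , σ ⟫
pairing-split D B σ k = begin
  sum (λ v → D v * σ v)
    ≡⟨ sum-cong-≗ (λ v → split (D v) (B v) (σ v) k) ⟩
  sum (λ v → (D v - k * B v) * σ v + k * (B v * σ v))
    ≡⟨ ∑-distrib-+ (λ v → (D v - k * B v) * σ v) (λ v → k * (B v * σ v)) ⟩
  ⟪ (λ v → D v - k * B v) , σ ⟫ + sum (λ v → k * (B v * σ v))
    ≡⟨ cong (_+_ ⟪ (λ v → D v - k * B v) , σ ⟫) (*-distribˡ-sum k (λ v → B v * σ v)) ⟨
  ⟪ (λ v → D v - k * B v) , σ ⟫ + k * ⟪ B , σ ⟫
    ∎
  where
  split : ∀ d b s k → d * s ≡ (d - k * b) * s + k * (b * s)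
  split = solve-∀

module _ {n} (H : Multigraph n) where

  private
    A : Fin n → Fin n → ℤ
    A v w = + adj H v w

  laplacian-as-sum : ∀ σ v → Laplacian H σ v ≡ sum (λ w → A v w * (σ v - σ w))
  laplacian-as-sum σ v = begin
    valency H v * σ v - ∑ (λ w → A v w * σ w)
      ≡⟨ cong₂ (λ a b → a * σ v - b) (∑≡sum (A v)) (∑≡sum (λ w → A v w * σ w)) ⟩
    sum (A v) * σ v - sum (λ w → A v w * σ w)
      ≡⟨ cong (_- sum (λ w → A v w * σ w)) (*-distribʳ-sum (σ v) (A v)) ⟩
    sum (λ w → A v w * σ v) - sum (λ w → A v w * σ w)
      ≡⟨ sum-sub (λ w → A v w * σ v) (λ w → A v w * σ w) ⟨
    sum (λ w → A v w * σ v - A v w * σ w)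
      ≡⟨ sum-cong-≗ (λ w → factor (A v w) (σ v) (σ w)) ⟩
    sum (λ w → A v w * (σ v - σ w))
      ∎
    where
    factor : ∀ a s t → a * s - a * t ≡ a * (s - t)
    factor = solve-∀

  laplacian-+ : ∀ σ τ v → Laplacian H (λ u → σ u + τ u) v ≡ Laplacian H σ v + Laplacian H τ v
  laplacian-+ σ τ v = begin
    Laplacian H (λ u → σ u + τ u) v
      ≡⟨ laplacian-as-sum _ v ⟩
    sum (λ w → A v w * ((σ v + τ v) - (σ w + τ w)))
      ≡⟨ sum-cong-≗ (λ w → distrib (A v w) (σ v) (τ v) (σ w) (τ w)) ⟩
    sum (λ w → A v w * (σ v - σ w) + A v w * (τ v - τ w))
      ≡⟨ ∑-distrib-+ (λ w → A v w * (σ v - σ w)) (λ w → A v w * (τ v - τ w)) ⟩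
    sum (λ w → A v w * (σ v - σ w)) + sum (λ w → A v w * (τ v - τ w))
      ≡⟨ cong₂ _+_ (laplacian-as-sum σ v) (laplacian-as-sum τ v) ⟨
    Laplacian H σ v + Laplacian H τ v
      ∎
    where
    distrib : ∀ a s t s′ t′ → a * ((s + t) - (s′ + t′)) ≡ a * (s - s′) + a * (t - t′)
    distrib = solve-∀

  laplacian-of-differences : ∀ {σ τ} k → (∀ v w → σ v - σ w ≡ k * (τ v - τ w)) →
                             ∀ v → Laplacian H σ v ≡ k * Laplacian H τ v
  laplacian-of-differences {σ} {τ} k σ≡kτ v = begin
    Laplacian H σ v                       ≡⟨ laplacian-as-sum σ v ⟩
    sum (λ w → A v w * (σ v - σ w))       ≡⟨ sum-cong-≗ (λ w → cong (A v w *_) (σ≡kτ v w)) ⟩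
    sum (λ w → A v w * (k * (τ v - τ w))) ≡⟨ sum-cong-≗ (λ w → swap (A v w) k (τ v - τ w)) ⟩
    sum (λ w → k * (A v w * (τ v - τ w))) ≡⟨ *-distribˡ-sum k (λ w → A v w * (τ v - τ w)) ⟨
    k * sum (λ w → A v w * (τ v - τ w))   ≡⟨ cong (k *_) (laplacian-as-sum τ v) ⟨
    k * Laplacian H τ v                   ∎
    where
    swap : ∀ a k d → a * (k * d) ≡ k * (a * d)
    swap = solve-∀

  private
    cross : (σ τ : Fin n → ℤ) → ℤ
    cross σ τ = sum (λ v → sum (λ w → A v w * σ w * τ v))

    cross-sym : ∀ σ τ → cross σ τ ≡ cross τ σ
    cross-sym σ τ = begin
      sum (λ v → sum (λ w → A v w * σ w * τ v)) ≡⟨ ∑-comm (λ v w → A v w * σ w * τ v) ⟩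
      sum (λ w → sum (λ v → A v w * σ w * τ v)) ≡⟨ sum-cong-≗ (λ w → sum-cong-≗ (λ v → flip v w)) ⟩
      sum (λ w → sum (λ v → A w v * τ v * σ w)) ∎
      where
      reorder : ∀ a s t → a * s * t ≡ a * t * s
      reorder = solve-∀
      flip : ∀ v w → A v w * σ w * τ v ≡ A w v * τ v * σ w
      flip v w = trans (reorder (A v w) (σ w) (τ v)) (cong (λ a → + a * τ v * σ w) (adj-sym H v w))

    pairing-laplacian : ∀ σ τ → ⟪ Laplacian H σ , τ ⟫ ≡ sum (λ v → valency H v * (σ v * τ v)) - cross σ τ
    pairing-laplacian σ τ = begin
      sum (λ v → Laplacian H σ v * τ v)
        ≡⟨ sum-cong-≗ expand ⟩
      sum (λ v → valency H v * (σ v * τ v) - sum (λ w → A v w * σ w * τ v))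
        ≡⟨ sum-sub (λ v → valency H v * (σ v * τ v)) (λ v → sum (λ w → A v w * σ w * τ v)) ⟩
      sum (λ v → valency H v * (σ v * τ v)) - cross σ τ
        ∎
      where
      distrib : ∀ d s t X → (d * s - X) * t ≡ d * (s * t) - X * t
      distrib = solve-∀
      expand : ∀ v → Laplacian H σ v * τ v ≡ valency H v * (σ v * τ v) - sum (λ w → A v w * σ w * τ v)
      expand v = begin
        (valency H v * σ v - ∑ (λ w → A v w * σ w)) * τ v
          ≡⟨ distrib (valency H v) (σ v) (τ v) _ ⟩
        valency H v * (σ v * τ v) - ∑ (λ w → A v w * σ w) * τ v
          ≡⟨ cong (λ X → valency H v * (σ v * τ v) - X * τ v) (∑≡sum (λ w → A v w * σ w)) ⟩
        valency H v * (σ v * τ v) - sum (λ w → A v w * σ w) * τ v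
          ≡⟨ cong (_-_ (valency H v * (σ v * τ v))) (*-distribʳ-sum (τ v) (λ w → A v w * σ w)) ⟩
        valency H v * (σ v * τ v) - sum (λ w → A v w * σ w * τ v)
          ∎

  laplacian-self-adjoint : ∀ σ τ → ⟪ Laplacian H σ , τ ⟫ ≡ ⟪ σ , Laplacian H τ ⟫
  laplacian-self-adjoint σ τ = begin
    ⟪ Laplacian H σ , τ ⟫
      ≡⟨ pairing-laplacian σ τ ⟩
    sum (λ v → valency H v * (σ v * τ v)) - cross σ τ
      ≡⟨ cong₂ _-_ (sum-cong-≗ (λ v → cong (valency H v *_) (ℤ.*-comm (σ v) (τ v)))) (cross-sym σ τ) ⟩
    sum (λ v → valency H v * (τ v * σ v)) - cross τ σ
      ≡⟨ pairing-laplacian τ σ ⟨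
    ⟪ Laplacian H τ , σ ⟫
      ≡⟨ pairing-comm (Laplacian H τ) σ ⟩
    ⟪ σ , Laplacian H τ ⟫
      ∎

module _ {n} {x y : Fin n} where

  δ-source : δ x y x ≡ -1ℤ
  δ-source with x ≟ x
  ... | yes _   = refl
  ... | no x≢x = contradiction refl x≢x

  δ-target : x ≢ y → δ x y y ≡ 1ℤ
  δ-target x≢y with y ≟ x | y ≟ y
  ... | yes y≡x | _       = contradiction (sym y≡x) x≢y
  ... | no _    | yes _   = refl
  ... | no _    | no y≢y = contradiction refl y≢y

  δ-elsewhere : ∀ {w} → w ≢ x → w ≢ y → δ x y w ≡ 0ℤ
  δ-elsewhere {w} w≢x w≢y with w ≟ x | w ≟ y
  ... | yes w≡x | _       = contradiction w≡x w≢x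
  ... | no _    | yes w≡y = contradiction w≡y w≢y
  ... | no _    | no _    = refl

  deg-δ : x ≢ y → deg (δ x y) ≡ 0ℤ
  deg-δ x≢y = begin
    ∑ (δ x y)           ≡⟨ ∑≡sum (δ x y) ⟩
    sum (δ x y)         ≡⟨ sum-pair (δ x y) x≢y (λ w → δ-elsewhere) ⟩
    δ x y x + δ x y y   ≡⟨ cong₂ _+_ δ-source (δ-target x≢y) ⟩
    0ℤ                  ∎

  edgeXY-x-y : edgeXY x y x y ≡ 1
  edgeXY-x-y with x ≟ x | y ≟ y
  ... | yes _ | yes _   = refl
  ... | no x≢x | _      = contradiction refl x≢x
  ... | yes _ | no y≢y = contradiction refl y≢y

  edgeXY-y-x : edgeXY x y y x ≡ 1
  edgeXY-y-x with y ≟ x | x ≟ y | y ≟ y | x ≟ x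
  ... | yes _ | yes _ | _      | _      = refl
  ... | yes _ | no _  | yes _  | yes _  = refl
  ... | no _  | _     | yes _  | yes _  = refl
  ... | _     | _     | no y≢y | _      = contradiction refl y≢y
  ... | _     | _     | _      | no x≢x = contradiction refl x≢x

  edgeXY-off : ∀ {u w} → ¬ (u ≡ x × w ≡ y) → ¬ (u ≡ y × w ≡ x) → edgeXY x y u w ≡ 0
  edgeXY-off {u} {w} ¬xy ¬yx with u ≟ x | w ≟ y | u ≟ y | w ≟ x
  ... | yes p | yes q | _     | _     = contradiction (p , q) ¬xy
  ... | _     | _     | yes p | yes q = contradiction (p , q) ¬yx
  ... | yes _ | no _  | yes _ | no _  = refl
  ... | yes _ | no _  | no _  | _     = refl
  ... | no _  | _     | yes _ | no _  = refl
  ... | no _  | _     | no _  | _     = refl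

  pairing-δ : x ≢ y → (σ : Fin n → ℤ) → ⟪ δ x y , σ ⟫ ≡ σ y - σ x
  pairing-δ x≢y σ = begin
    sum (λ v → δ x y v * σ v)       ≡⟨ sum-pair _ x≢y (λ w w≢x w≢y → cong (_* σ w) (δ-elsewhere w≢x w≢y)) ⟩
    δ x y x * σ x + δ x y y * σ y   ≡⟨ cong₂ (λ a b → a * σ x + b * σ y) δ-source (δ-target x≢y) ⟩
    -1ℤ * σ x + 1ℤ * σ y            ≡⟨ difference (σ x) (σ y) ⟩
    σ y - σ x                       ∎
    where
    difference : ∀ a b → -1ℤ * a + 1ℤ * b ≡ b - a
    difference = solve-∀

  module _ (x≢y : x ≢ y) where

    edge-laplacian : (Fin n → ℤ) → Fin n → ℤ
    edge-laplacian τ v = sum (λ w → + edgeXY x y v w * (τ v - τ w))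

    edge-laplacian-source : ∀ τ → edge-laplacian τ x ≡ (τ y - τ x) * δ x y x
    edge-laplacian-source τ = begin
      sum (λ w → + edgeXY x y x w * (τ x - τ w))
        ≡⟨ sum-pair _ x≢y (λ w w≢x w≢y → cong (λ e → + e * (τ x - τ w)) (edgeXY-off {x} {w} (w≢y ∘ proj₂) (w≢x ∘ proj₂))) ⟩
      + edgeXY x y x x * (τ x - τ x) + + edgeXY x y x y * (τ x - τ y)
        ≡⟨ cong (λ e → + edgeXY x y x x * (τ x - τ x) + + e * (τ x - τ y)) edgeXY-x-y ⟩
      + edgeXY x y x x * (τ x - τ x) + 1ℤ * (τ x - τ y)
        ≡⟨ at-source (+ edgeXY x y x x) (τ x) (τ y) ⟩
      (τ y - τ x) * -1ℤ
        ≡⟨ cong ((τ y - τ x) *_) δ-source ⟨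
      (τ y - τ x) * δ x y x
        ∎
      where
      at-source : ∀ e s t → e * (s - s) + 1ℤ * (s - t) ≡ (t - s) * -1ℤ
      at-source = solve-∀

    edge-laplacian-target : ∀ τ → edge-laplacian τ y ≡ (τ y - τ x) * δ x y y
    edge-laplacian-target τ = begin
      sum (λ w → + edgeXY x y y w * (τ y - τ w))
        ≡⟨ sum-pair _ x≢y (λ w w≢x w≢y → cong (λ e → + e * (τ y - τ w)) (edgeXY-off {y} {w} (w≢y ∘ proj₂) (w≢x ∘ proj₂))) ⟩
      + edgeXY x y y x * (τ y - τ x) + + edgeXY x y y y * (τ y - τ y)
        ≡⟨ cong (λ e → + e * (τ y - τ x) + + edgeXY x y y y * (τ y - τ y)) edgeXY-y-x ⟩
      1ℤ * (τ y - τ x) + + edgeXY x y y y * (τ y - τ y)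
        ≡⟨ at-target (+ edgeXY x y y y) (τ x) (τ y) ⟩
      (τ y - τ x) * 1ℤ
        ≡⟨ cong ((τ y - τ x) *_) (δ-target x≢y) ⟨
      (τ y - τ x) * δ x y y
        ∎
      where
      at-target : ∀ e s t → 1ℤ * (t - s) + e * (t - t) ≡ (t - s) * 1ℤ
      at-target = solve-∀

    edge-laplacian-elsewhere : ∀ τ {v} → v ≢ x → v ≢ y → edge-laplacian τ v ≡ (τ y - τ x) * δ x y v
    edge-laplacian-elsewhere τ {v} v≢x v≢y = begin
      sum (λ w → + edgeXY x y v w * (τ v - τ w))
        ≡⟨ sum-zero (λ w → cong (λ e → + e * (τ v - τ w)) (edgeXY-off {v} {w} (v≢x ∘ proj₁) (v≢y ∘ proj₁))) ⟩
      0ℤ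
        ≡⟨ ℤ.*-zeroʳ (τ y - τ x) ⟨
      (τ y - τ x) * 0ℤ
        ≡⟨ cong ((τ y - τ x) *_) (δ-elsewhere v≢x v≢y) ⟨
      (τ y - τ x) * δ x y v
        ∎

    edge-laplacian-δ : ∀ τ v → edge-laplacian τ v ≡ (τ y - τ x) * δ x y v
    edge-laplacian-δ τ v = by-cases (v ≟ x) (v ≟ y)
      where
      Claim : Fin n → Set
      Claim u = edge-laplacian τ u ≡ (τ y - τ x) * δ x y u
      by-cases : Dec (v ≡ x) → Dec (v ≡ y) → Claim v
      by-cases (yes v≡x) _         = subst Claim (sym v≡x) (edge-laplacian-source τ)
      by-cases (no _)    (yes v≡y) = subst Claim (sym v≡y) (edge-laplacian-target τ)
      by-cases (no v≢x)  (no v≢y)  = edge-laplacian-elsewhere τ v≢x v≢y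

    laplacian-add-edge : ∀ {H H′ : Multigraph n} → (∀ u w → adj H′ u w ≡ adj H u w ℕ.+ edgeXY x y u w) →
                         ∀ τ v → Laplacian H′ τ v ≡ Laplacian H τ v + (τ y - τ x) * δ x y v
    laplacian-add-edge {H} {H′} H′≡H+xy τ v = begin
      Laplacian H′ τ v
        ≡⟨ laplacian-as-sum H′ τ v ⟩
      sum (λ w → + adj H′ v w * (τ v - τ w))
        ≡⟨ sum-cong-≗ split ⟩
      sum (λ w → + adj H v w * (τ v - τ w) + + edgeXY x y v w * (τ v - τ w))
        ≡⟨ ∑-distrib-+ (λ w → + adj H v w * (τ v - τ w)) (λ w → + edgeXY x y v w * (τ v - τ w)) ⟩
      sum (λ w → + adj H v w * (τ v - τ w)) + sum (λ w → + edgeXY x y v w * (τ v - τ w))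
        ≡⟨ cong₂ _+_ (sym (laplacian-as-sum H τ v)) (edge-laplacian-δ τ v) ⟩
      Laplacian H τ v + (τ y - τ x) * δ x y v
        ∎
      where
      split : ∀ w → + adj H′ v w * (τ v - τ w) ≡ + adj H v w * (τ v - τ w) + + edgeXY x y v w * (τ v - τ w)
      split w = begin
        + adj H′ v w * (τ v - τ w)                               ≡⟨ cong (λ a → + a * (τ v - τ w)) (H′≡H+xy v w) ⟩
        + (adj H v w ℕ.+ edgeXY x y v w) * (τ v - τ w)           ≡⟨ cong (_* (τ v - τ w)) (ℤ.pos-+ (adj H v w) (edgeXY x y v w)) ⟩
        (+ adj H v w + + edgeXY x y v w) * (τ v - τ w)           ≡⟨ ℤ.*-distribʳ-+ (τ v - τ w) (+ adj H v w) (+ edgeXY x y v w) ⟩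
        + adj H v w * (τ v - τ w) + + edgeXY x y v w * (τ v - τ w) ∎

    laplacian-one-edge-change : ∀ {G G1} → OneEdgeChange G x y G1 → ∀ τ →
      ∃[ c ] ((c ≡ τ y - τ x ⊎ c ≡ - (τ y - τ x)) × (∀ v → Laplacian G1 τ v ≡ Laplacian G τ v + c * δ x y v))
    laplacian-one-edge-change {G} {G1} (added G1≡G+xy) τ = τ y - τ x , inj₁ refl , laplacian-add-edge {G} {G1} G1≡G+xy τ
    laplacian-one-edge-change {G} {G1} (removed G≡G1+xy) τ = - (τ y - τ x) , inj₂ refl , λ v →
      move (Laplacian G τ v) (Laplacian G1 τ v) (τ y - τ x) (δ x y v) (laplacian-add-edge {G1} {G} G≡G1+xy τ v)
      where
      cancel : ∀ b s d → b ≡ b + s * d + (- s) * d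
      cancel = solve-∀
      move : ∀ a b s d → a ≡ b + s * d → b ≡ a + (- s) * d
      move a b s d refl = cancel b s d

Principal : ∀ {n} → Multigraph n → Divisor n → Set
Principal H D = ∃[ σ ] (∀ v → D v ≡ Laplacian H σ v)

module _ {n} (H : Multigraph n) where

  principal-cong : ∀ {D E : Divisor n} → (∀ v → D v ≡ E v) → Principal H D → Principal H E
  principal-cong D≡E (σ , D≡Lσ) = σ , λ v → trans (sym (D≡E v)) (D≡Lσ v)

  principal-zero : Principal H (λ _ → 0ℤ)
  principal-zero = (λ _ → 0ℤ) , λ v → sym (laplacian-of-differences H {τ = λ _ → 0ℤ} 0ℤ (λ _ _ → refl) v)

  principal-+ : ∀ {D E : Divisor n} → Principal H D → Principal H E → Principal H (λ v → D v + E v)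
  principal-+ (σ , D≡Lσ) (τ , E≡Lτ) =
    (λ u → σ u + τ u) , λ v → trans (cong₂ _+_ (D≡Lσ v) (E≡Lτ v)) (sym (laplacian-+ H σ τ v))

  principal-scale : ∀ k {D : Divisor n} → Principal H D → Principal H (λ v → k * D v)
  principal-scale k (σ , D≡Lσ) =
    (λ u → k * σ u) , λ v → trans (cong (k *_) (D≡Lσ v))
      (sym (laplacian-of-differences H k (λ v w → distrib k (σ v) (σ w)) v))
    where
    distrib : ∀ k s t → k * s - k * t ≡ k * (s - t)
    distrib = solve-∀

  principal-- : ∀ {D E : Divisor n} → Principal H D → Principal H E → Principal H (λ v → D v - E v)
  principal-- {D} {E} PD PE = principal-cong (λ v → cong (_+_ (D v)) (ℤ.-1*i≡-i (E v))) (principal-+ PD (principal-scale -1ℤ PE))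

  principal-sum : ∀ {N} (D : Fin N → Divisor n) → (∀ i → Principal H (D i)) → Principal H (λ v → sum (λ i → D i v))
  principal-sum {zero}  D PD = principal-zero
  principal-sum {suc N} D PD = principal-+ (PD zero) (principal-sum (D ∘ suc) (PD ∘ suc))

LaplaciansDifferBy : ∀ {n} → Multigraph n → Multigraph n → Divisor n → Set
LaplaciansDifferBy H H′ B = ∀ τ → ∃[ c ] (∀ v → Laplacian H′ τ v ≡ Laplacian H τ v + c * B v)

LaplaciansDifferBy-sym : ∀ {n} {H H′ : Multigraph n} {B} → LaplaciansDifferBy H H′ B → LaplaciansDifferBy H′ H B
LaplaciansDifferBy-sym {H = H} {H′} {B} L′≡L+cB τ with L′≡L+cB τ
... | c , L′τ≡Lτ+cB = - c , λ v → begin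
  Laplacian H τ v                          ≡⟨ cancel (Laplacian H τ v) c (B v) ⟩
  (Laplacian H τ v + c * B v) + - c * B v  ≡⟨ cong (_+ - c * B v) (L′τ≡Lτ+cB v) ⟨
  Laplacian H′ τ v + - c * B v             ∎
  where
  cancel : ∀ l c b → l ≡ (l + c * b) + - c * b
  cancel = solve-∀

record InSpan {n} (H : Multigraph n) (B D : Divisor n) : Set where
  constructor span
  field
    coefficient : ℤ
    principal   : Principal H (λ v → D v - coefficient * B v)

GeneratedBy : ∀ {n} → Multigraph n → Divisor n → Set
GeneratedBy H B = ∀ D → deg D ≡ 0ℤ → InSpan H B D

Generates⇒GeneratedBy : ∀ {n} {H : Multigraph n} {x y} → Generates H x y → GeneratedBy H (δ x y)
Generates⇒GeneratedBy generates D degD with generates D degD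
... | k , D∼kδ = span k D∼kδ

GeneratedBy⇒Generates : ∀ {n} {H : Multigraph n} {x y} → GeneratedBy H (δ x y) → Generates H x y
GeneratedBy⇒Generates generated D degD with generated D degD
... | span k D∼kδ = k , D∼kδ

bezout-combination : ∀ {a b M M′ : ℕ} d → 1 ℕ.+ b ℕ.* M′ ≡ a ℕ.* M → + a * (+ M * d) + (- + b) * (+ M′ * d) ≡ d
bezout-combination {a} {b} {M} {M′} d 1+bM′≡aM = begin
  + a * (+ M * d) + (- + b) * (+ M′ * d)     ≡⟨ regroup (+ a) (+ M) (+ b) (+ M′) d ⟩
  + a * + M * d - + b * + M′ * d             ≡⟨ cong₂ (λ p q → p * d - q * d) (ℤ.pos-* a M) (ℤ.pos-* b M′) ⟨
  + (a ℕ.* M) * d - + (b ℕ.* M′) * d         ≡⟨ cong (λ p → + p * d - + (b ℕ.* M′) * d) 1+bM′≡aM ⟨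
  + (1 ℕ.+ b ℕ.* M′) * d - + (b ℕ.* M′) * d  ≡⟨ cancel (+ (b ℕ.* M′)) d ⟩
  d                                          ∎
  where
  regroup : ∀ a M b M′ d → a * (M * d) + (- b) * (M′ * d) ≡ a * M * d - b * M′ * d
  regroup = solve-∀
  cancel : ∀ k d → (1ℤ + k) * d - k * d ≡ d
  cancel = solve-∀

module _ {n} {H : Multigraph n} {B : Divisor n} where

  span-principal : ∀ {D} → Principal H D → InSpan H B D
  span-principal {D} PD = span 0ℤ (principal-cong H (λ v → sym (ℤ.+-identityʳ (D v))) PD)

  span-cong : ∀ {D E} → (∀ v → D v ≡ E v) → InSpan H B D → InSpan H B E
  span-cong D≡E (span k P) = span k (principal-cong H (λ v → cong (_- k * B v) (D≡E v)) P)

  span-+ : ∀ {D E} → InSpan H B D → InSpan H B E → InSpan H B (λ v → D v + E v)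
  span-+ {D} {E} (span k PD) (span l PE) =
    span (k + l) (principal-cong H (λ v → regroup (D v) (E v) k l (B v)) (principal-+ H PD PE))
    where
    regroup : ∀ d e k l b → (d - k * b) + (e - l * b) ≡ (d + e) - (k + l) * b
    regroup = solve-∀

  span-scale : ∀ a {D} → InSpan H B D → InSpan H B (λ v → a * D v)
  span-scale a {D} (span k PD) = span (a * k) (principal-cong H (λ v → distrib a (D v) k (B v)) (principal-scale H a PD))
    where
    distrib : ∀ a d k b → a * (d - k * b) ≡ a * d - (a * k) * b
    distrib = solve-∀

  span-transfer : ∀ {H′} → LaplaciansDifferBy H H′ B → ∀ {D} → InSpan H B D → InSpan H′ B D
  span-transfer {H′} L′≡L+cB {D} (span k (τ , D-kB≡Lτ)) with L′≡L+cB τ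
  ... | c , L′τ≡Lτ+cB = span (k - c) (τ , λ v → begin
    D v - (k - c) * B v         ≡⟨ shift (D v) k c (B v) ⟩
    (D v - k * B v) + c * B v   ≡⟨ cong (_+ c * B v) (D-kB≡Lτ v) ⟩
    Laplacian H τ v + c * B v   ≡⟨ L′τ≡Lτ+cB v ⟨
    Laplacian H′ τ v            ∎)
    where
    shift : ∀ d k c b → d - (k - c) * b ≡ (d - k * b) + c * b
    shift = solve-∀

  span-of-coprime-multiples : ∀ {M M′ D} → gcd M M′ ≡ 1 →
    InSpan H B (λ v → + M * D v) → InSpan H B (λ v → + M′ * D v) → InSpan H B D
  span-of-coprime-multiples {M} {M′} {D} coprime MD M′D
    with subst (λ d → Bézout.Identity d M M′) coprime (Bézout.identity (gcd-GCD M M′))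
  ... | Bézout.+- a b 1+bM′≡aM =
    span-cong (λ v → bezout-combination {a} {b} {M} {M′} (D v) 1+bM′≡aM)
      (span-+ (span-scale (+ a) MD) (span-scale (- + b) M′D))
  ... | Bézout.-+ a b 1+aM≡bM′ =
    span-cong (λ v → bezout-combination {b} {a} {M′} {M} (D v) 1+aM≡bM′)
      (span-+ (span-scale (+ b) M′D) (span-scale (- + a) MD))

pairing-principal : ∀ {n} (H : Multigraph n) {D B σ : Divisor n} {c} →
                    Principal H D → (∀ v → c * B v ≡ Laplacian H σ v) → c ∣ ⟪ D , σ ⟫
pairing-principal H {D} {B} {σ} {c} (τ , D≡Lτ) cB≡Lσ = divides ⟪ τ , B ⟫ (begin
  ⟪ D , σ ⟫                ≡⟨ sum-cong-≗ (λ v → cong (_* σ v) (D≡Lτ v)) ⟩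
  ⟪ Laplacian H τ , σ ⟫    ≡⟨ laplacian-self-adjoint H τ σ ⟩
  ⟪ τ , Laplacian H σ ⟫    ≡⟨ sum-cong-≗ (λ v → cong (τ v *_) (cB≡Lσ v)) ⟨
  ⟪ τ , (λ v → c * B v) ⟫  ≡⟨ pairing-scaleʳ τ B c ⟩
  c * ⟪ τ , B ⟫            ≡⟨ ℤ.*-comm c ⟪ τ , B ⟫ ⟩
  ⟪ τ , B ⟫ * c            ∎)

divides-potential-differences : ∀ {n} {H : Multigraph n} {B σ : Divisor n} {c d} → GeneratedBy H B →
  (∀ v → c * B v ≡ Laplacian H σ v) → d ∣ c → d ∣ ⟪ B , σ ⟫ → ∀ x v → d ∣ σ v - σ x
divides-potential-differences {H = H} {B} {σ} {d = d} generated cB≡Lσ d∣c d∣⟨B,σ⟩ x v with x ≟ v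
... | yes refl = divides 0ℤ (ℤ.+-inverseʳ (σ x))
... | no x≢v with generated (δ x v) (deg-δ x≢v)
...   | span k P = subst (d ∣_) ⟨δxv,σ⟩≡σv-σx
        (∣m∣n⇒∣m+n (∣-trans d∣c (pairing-principal H P cB≡Lσ)) (∣n⇒∣m*n k d∣⟨B,σ⟩))
  where
  ⟨δxv,σ⟩≡σv-σx : ⟪ (λ u → δ x v u - k * B u) , σ ⟫ + k * ⟪ B , σ ⟫ ≡ σ v - σ x
  ⟨δxv,σ⟩≡σv-σx = trans (sym (pairing-split (δ x v) B σ k)) (pairing-δ x≢v σ)

principal-of-divisible-potential : ∀ {n} (H : Multigraph n) {σ D : Divisor n} g .{{_ : ℕ.NonZero g}} x →
  (∀ v → + g ∣ σ v - σ x) → (∀ v → + g * D v ≡ Laplacian H σ v) → Principal H D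
principal-of-divisible-potential {n} H {σ} {D} g x g∣σ-σx gD≡Lσ =
  τ , λ v → ℤ.*-cancelˡ-≡ (+ g) (D v) (Laplacian H τ v) (trans (gD≡Lσ v) (laplacian-of-differences H (+ g) scaled v))
  where
  τ : Fin n → ℤ
  τ v = _∣_.quotient (g∣σ-σx v)
  rebase : ∀ a b c → a - b ≡ (a - c) - (b - c)
  rebase = solve-∀
  factor : ∀ s t g → s * g - t * g ≡ g * (s - t)
  factor = solve-∀
  scaled : ∀ v w → σ v - σ w ≡ + g * (τ v - τ w)
  scaled v w = begin
    σ v - σ w                  ≡⟨ rebase (σ v) (σ w) (σ x) ⟩
    (σ v - σ x) - (σ w - σ x)  ≡⟨ cong₂ _-_ (_∣_.equality (g∣σ-σx v)) (_∣_.equality (g∣σ-σx w)) ⟩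
    τ v * + g - τ w * + g      ≡⟨ factor (τ v) (τ w) (+ g) ⟩
    + g * (τ v - τ w)          ∎

cofactor≡1 : ∀ {m k g} .{{_ : ℕ.NonZero m}} → m ≡ k ℕ.* g → m ℕ.∣ k → g ≡ 1
cofactor≡1 {m} {k} {g} m≡k*g m∣k = sym (ℕ.*-cancelˡ-≡ 1 g m (begin
  m ℕ.* 1  ≡⟨ ℕ.*-identityʳ m ⟩
  m        ≡⟨ m≡k*g ⟩
  k ℕ.* g  ≡⟨ cong (ℕ._* g) k≡m ⟩
  m ℕ.* g  ∎))
  where
  k≡m : k ≡ m
  k≡m = ℕ.∣-antisym (ℕ.divides g (trans m≡k*g (ℕ.*-comm k g))) m∣k

module Jacobian {n} (H : Multigraph n) {N} (J : JacHasOrder H N) where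

  rep : Fin N → Divisor n
  rep i = proj₁ (proj₁ J i)

  deg-rep : ∀ i → deg (rep i) ≡ 0ℤ
  deg-rep i = proj₂ (proj₁ J i)

  class : (D : Divisor n) → deg D ≡ 0ℤ → Fin N
  class D degD = proj₁ (proj₁ (proj₂ J) (D , degD))

  rep-class : ∀ D degD → rep (class D degD) ∼[ H ] D
  rep-class D degD = proj₂ (proj₁ (proj₂ J) (D , degD))

  rep-injective : ∀ {i j} → rep i ∼[ H ] rep j → i ≡ j
  rep-injective = proj₂ (proj₂ J) _ _

  instance
    order-nonZero : ℕ.NonZero N
    order-nonZero = nonZeroIndex (class (λ _ → 0ℤ) (deg-zero n))

  module _ (D : Divisor n) (degD : deg D ≡ 0ℤ) where

    translate : Fin N → Fin N
    translate i = class (λ v → rep i v + D v) (deg-+ (rep i) D (deg-rep i) degD)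

    rep-translate : ∀ i → rep (translate i) ∼[ H ] (λ v → rep i v + D v)
    rep-translate i = rep-class _ _

  translate-cancel : ∀ {D E} degD degE → (∀ v → D v + E v ≡ 0ℤ) → ∀ i → translate E degE (translate D degD i) ≡ i
  translate-cancel {D} {E} degD degE D+E≡0 i =
    rep-injective (principal-cong H regroup (principal-+ H (rep-translate E degE j) (rep-translate D degD i)))
    where
    j k : Fin N
    j = translate D degD i
    k = translate E degE j
    telescope : ∀ a b c d e → (a - (b + e)) + (b - (c + d)) ≡ (a - c) - (d + e)
    telescope = solve-∀
    regroup : ∀ v → (rep k v - (rep j v + E v)) + (rep j v - (rep i v + D v)) ≡ rep k v - rep i v
    regroup v = begin
      (rep k v - (rep j v + E v)) + (rep j v - (rep i v + D v)) ≡⟨ telescope (rep k v) (rep j v) (rep i v) (D v) (E v) ⟩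
      (rep k v - rep i v) - (D v + E v)                           ≡⟨ cong (λ z → rep k v - rep i v - z) (D+E≡0 v) ⟩
      (rep k v - rep i v) - 0ℤ                                    ≡⟨ ℤ.+-identityʳ (rep k v - rep i v) ⟩
      rep k v - rep i v                                           ∎

  -- Summing rep (T i) ∼ rep i + D over the permutation T of the classes leaves N·D ∼ 0.
  order-annihilates : ∀ D → deg D ≡ 0ℤ → Principal H (λ v → + N * D v)
  order-annihilates D degD =
    principal-cong H collapse (principal-scale H -1ℤ (principal-sum H _ (rep-translate D degD)))
    where
    T : Fin N → Fin N
    T = translate D degD
    -D : Divisor n
    -D v = -1ℤ * D v
    deg-D : deg -D ≡ 0ℤ
    deg-D = deg-scale -1ℤ D degD
    cancels : ∀ d → d + -1ℤ * d ≡ 0ℤ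
    cancels = solve-∀
    π : Permutation N N
    π = permutation T (translate -D deg-D)
          (translate-cancel deg-D degD (λ v → trans (ℤ.+-comm (-D v) (D v)) (cancels (D v))))
          (translate-cancel degD deg-D (λ v → cancels (D v)))
    collapse : ∀ v → -1ℤ * sum (λ i → rep (T i) v - (rep i v + D v)) ≡ + N * D v
    collapse v = begin
      -1ℤ * sum (λ i → rep (T i) v - (rep i v + D v))
        ≡⟨ cong (-1ℤ *_) (sum-sub (λ i → rep (T i) v) (λ i → rep i v + D v)) ⟩
      -1ℤ * (sum (λ i → rep (T i) v) - sum (λ i → rep i v + D v))
        ≡⟨ cong₂ (λ a b → -1ℤ * (a - b)) (sym (sum-permute (λ i → rep i v) π)) (∑-distrib-+ (λ i → rep i v) (λ _ → D v)) ⟩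
      -1ℤ * (sum (λ i → rep i v) - (sum (λ i → rep i v) + sum {N} (λ _ → D v)))
        ≡⟨ cong (λ c → -1ℤ * (sum (λ i → rep i v) - (sum (λ i → rep i v) + c))) (sum-const N (D v)) ⟩
      -1ℤ * (sum (λ i → rep i v) - (sum (λ i → rep i v) + + N * D v))
        ≡⟨ cancel (sum (λ i → rep i v)) (+ N * D v) ⟩
      + N * D v
        ∎
      where
      cancel : ∀ r c → -1ℤ * (r - (r + c)) ≡ c
      cancel = solve-∀

  module _ {B : Divisor n} (generated : GeneratedBy H B) where

    -- The residues mod r of the multipliers k with rep i ∼ k·B separate the N classes.
    order≤ : ∀ r .{{_ : ℕ.NonZero r}} → Principal H (λ v → + r * B v) → N ℕ.≤ r
    order≤ r rB = injective⇒≤ residue-injective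
      where
      multiplier : Fin N → ℤ
      multiplier i = InSpan.coefficient (generated (rep i) (deg-rep i))
      residue : Fin N → Fin r
      residue i = fromℕ< (n%ℕd<d (multiplier i) r)
      rep∼residue : ∀ i → Principal H (λ v → rep i v - + (multiplier i %ℕ r) * B v)
      rep∼residue i = principal-cong H reduce
        (principal-+ H (InSpan.principal (generated (rep i) (deg-rep i))) (principal-scale H (multiplier i /ℕ r) rB))
        where
        k : ℤ
        k = multiplier i
        drop : ∀ d b r′ q R → (d - (r′ + q * R) * b) + q * (R * b) ≡ d - r′ * b
        drop = solve-∀
        reduce : ∀ v → (rep i v - k * B v) + k /ℕ r * (+ r * B v) ≡ rep i v - + (k %ℕ r) * B v
        reduce v = trans (cong (λ c → (rep i v - c * B v) + k /ℕ r * (+ r * B v)) (a≡a%ℕn+[a/ℕn]*n k r))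
                         (drop (rep i v) (B v) (+ (k %ℕ r)) (k /ℕ r) (+ r))
      residue-injective : ∀ {i j} → residue i ≡ residue j → i ≡ j
      residue-injective {i} {j} same = rep-injective (principal-cong H cancel (principal-- H (rep∼residue i) rep-j∼residue-i))
        where
        same-ℕ : multiplier j %ℕ r ≡ multiplier i %ℕ r
        same-ℕ = trans (sym (toℕ-fromℕ< _)) (trans (cong toℕ (sym same)) (toℕ-fromℕ< _))
        rep-j∼residue-i : Principal H (λ v → rep j v - + (multiplier i %ℕ r) * B v)
        rep-j∼residue-i = subst (λ m → Principal H (λ v → rep j v - + m * B v)) same-ℕ (rep∼residue j)
        difference : ∀ a c e → (a - e) - (c - e) ≡ a - c
        difference = solve-∀
        cancel : ∀ v → (rep i v - + (multiplier i %ℕ r) * B v) - (rep j v - + (multiplier i %ℕ r) * B v) ≡ rep i v - rep j v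
        cancel v = difference (rep i v) (rep j v) _

    order-divides : deg B ≡ 0ℤ → ∀ c → Principal H (λ v → c * B v) → + N ∣ c
    order-divides degB c cB with c %ℕ N | a≡a%ℕn+[a/ℕn]*n c N | n%ℕd<d c N
    ... | zero  | c≡0+qN | _   = divides (c /ℕ N) (trans c≡0+qN (ℤ.+-identityˡ _))
    ... | suc r | c≡r+qN | r<N = contradiction (order≤ (suc r) remainder-principal) (ℕ.<⇒≱ r<N)
      where
      drop : ∀ r q N b → (r + q * N) * b - q * (N * b) ≡ r * b
      drop = solve-∀
      remainder : ∀ v → c * B v - c /ℕ N * (+ N * B v) ≡ + suc r * B v
      remainder v = trans (cong (λ z → z * B v - c /ℕ N * (+ N * B v)) c≡r+qN) (drop (+ suc r) (c /ℕ N) (+ N) (B v))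
      remainder-principal : Principal H (λ v → + suc r * B v)
      remainder-principal = principal-cong H remainder (principal-- H cB (principal-scale H (c /ℕ N) (order-annihilates B degB)))

    coprime-order-pairing : deg B ≡ 0ℤ → ∀ x {σ} → (∀ v → + N * B v ≡ Laplacian H σ v) →
                      ∀ {g} → g ℕ.∣ N → + g ∣ ⟪ B , σ ⟫ → g ≡ 1
    coprime-order-pairing degB x {σ} NB≡Lσ {g} (ℕ.divides k N≡k*g) g∣⟪B,σ⟫ = cofactor≡1 N≡k*g N∣k
      where
      instance
        g-nonZero : ℕ.NonZero g
        g-nonZero = ℕ.≢-nonZero λ g≡0 → ℕ.≢-nonZero⁻¹ N (trans N≡k*g (trans (cong (k ℕ.*_) g≡0) (ℕ.*-zeroʳ k)))
      g∣σ-differences : ∀ v → + g ∣ σ v - σ x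
      g∣σ-differences = divides-potential-differences {c = + N} generated NB≡Lσ (∣ᵤ⇒∣ (ℕ.divides k N≡k*g)) g∣⟪B,σ⟫ x
      regroup : ∀ g k b → g * (k * b) ≡ k * g * b
      regroup = solve-∀
      gkB≡NB : ∀ v → + g * (+ k * B v) ≡ + N * B v
      gkB≡NB v = begin
        + g * (+ k * B v)  ≡⟨ regroup (+ g) (+ k) (B v) ⟩
        + k * + g * B v    ≡⟨ cong (_* B v) (ℤ.pos-* k g) ⟨
        + (k ℕ.* g) * B v  ≡⟨ cong (λ m → + m * B v) N≡k*g ⟨
        + N * B v          ∎
      kB-principal : Principal H (λ v → + k * B v)
      kB-principal = principal-of-divisible-potential H g x g∣σ-differences (λ v → trans (gkB≡NB v) (NB≡Lσ v))
      N∣k : N ℕ.∣ k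
      N∣k = ∣⇒∣ᵤ (order-divides degB (+ k) kB-principal)

module _ {n} {G G1 : Multigraph n} {x y : Fin n} (x≢y : x ≢ y) (change : OneEdgeChange G x y G1) where

  laplacians-differ : LaplaciansDifferBy G G1 (δ x y)
  laplacians-differ τ with laplacian-one-edge-change x≢y change τ
  ... | c , _ , L1τ≡Lτ+cδ = c , L1τ≡Lτ+cδ

  span-to-G1 : ∀ {D} → InSpan G (δ x y) D → InSpan G1 (δ x y) D
  span-to-G1 = span-transfer laplacians-differ

  span-to-G : ∀ {D} → InSpan G1 (δ x y) D → InSpan G (δ x y) D
  span-to-G = span-transfer (LaplaciansDifferBy-sym {H = G} {G1} {δ x y} laplacians-differ)

  gcd-divides-pairing : ∀ {N N1} → JacHasOrder G1 N1 → GeneratedBy G1 (δ x y) → ∀ {σ} →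
                        (∀ v → + N * δ x y v ≡ Laplacian G σ v) → + gcd N N1 ∣ ⟪ δ x y , σ ⟫
  gcd-divides-pairing {N} {N1} JG1 generated1 {σ} Nδ≡Lσ with laplacian-one-edge-change x≢y change σ
  ... | c , c≡±s , L1σ≡Lσ+cδ = subst (+ g ∣_) (sym (pairing-δ x≢y σ)) (g∣s c≡±s)
    where
    g : ℕ
    g = gcd N N1
    g∣N : + g ∣ + N
    g∣N = ∣ᵤ⇒∣ (gcd[m,n]∣m N N1)
    g∣N1 : + g ∣ + N1
    g∣N1 = ∣ᵤ⇒∣ (gcd[m,n]∣n N N1)
    distrib : ∀ a c d → (a + c) * d ≡ a * d + c * d
    distrib = solve-∀
    [N+c]δ-principal : Principal G1 (λ v → (+ N + c) * δ x y v)
    [N+c]δ-principal = σ , λ v → begin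
      (+ N + c) * δ x y v              ≡⟨ distrib (+ N) c (δ x y v) ⟩
      + N * δ x y v + c * δ x y v      ≡⟨ cong (_+ c * δ x y v) (Nδ≡Lσ v) ⟩
      Laplacian G σ v + c * δ x y v    ≡⟨ L1σ≡Lσ+cδ v ⟨
      Laplacian G1 σ v                 ∎
    N1∣N+c : + N1 ∣ + N + c
    N1∣N+c = Jacobian.order-divides G1 JG1 generated1 (deg-δ x≢y) (+ N + c) [N+c]δ-principal
    g∣c : + g ∣ c
    g∣c = ∣m+n∣m⇒∣n (∣-trans g∣N1 N1∣N+c) g∣N
    g∣s : c ≡ σ y - σ x ⊎ c ≡ - (σ y - σ x) → + g ∣ σ y - σ x
    g∣s (inj₁ c≡s)  = subst (+ g ∣_) c≡s g∣c
    g∣s (inj₂ c≡-s) = subst (+ g ∣_) (trans (cong -_ c≡-s) (ℤ.neg-involutive _)) (∣m⇒∣-m g∣c)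

  coprime⇒generates : ∀ {N N1} → JacHasOrder G N → JacHasOrder G1 N1 → gcd N N1 ≡ 1 → Generates G x y
  coprime⇒generates {N} {N1} JG JG1 coprime = GeneratedBy⇒Generates {H = G} λ D degD →
    span-of-coprime-multiples {M = N} {N1} coprime
      (span-principal (Jacobian.order-annihilates G JG D degD))
      (span-to-G (span-principal (Jacobian.order-annihilates G1 JG1 D degD)))

  generates⇒coprime : ∀ {N N1} → JacHasOrder G N → JacHasOrder G1 N1 → Generates G x y → gcd N N1 ≡ 1
  generates⇒coprime {N} {N1} JG JG1 generates =
    Jacobian.coprime-order-pairing G JG generated (deg-δ x≢y) x Nδ≡Lσ (gcd[m,n]∣m N N1)
      (gcd-divides-pairing {N} JG1 (λ D degD → span-to-G1 (generated D degD)) Nδ≡Lσ)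
    where
    generated : GeneratedBy G (δ x y)
    generated = Generates⇒GeneratedBy {H = G} generates
    Nδ-principal : Principal G (λ v → + N * δ x y v)
    Nδ-principal = Jacobian.order-annihilates G JG (δ x y) (deg-δ x≢y)
    Nδ≡Lσ : ∀ v → + N * δ x y v ≡ Laplacian G (proj₁ Nδ-principal) v
    Nδ≡Lσ = proj₂ Nδ-principal

-- Connectedness is unused: it only makes Jac finite, which JacHasOrder already provides.
corollary1p2 : {n : ℕ} (G G1 : Multigraph n) (x y : Fin n) → ¬ (x ≡ y)
    → Connected G → OneEdgeChange G x y G1 → Connected G1
    → (N N1 : ℕ) → JacHasOrder G N → JacHasOrder G1 N1
    → (Generates G x y ⇔ gcd N N1 ≡ 1)
corollary1p2 G G1 x y x≢y _ change _ N N1 JG JG1 =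
  mk⇔ (generates⇒coprime x≢y change JG JG1) (coprime⇒generates x≢y change JG JG1)
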